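{- Let $G$ be a connected graph with at least three vertices. Three distinct vertices $u,v,w$ of $G$ have at least one median if and only if the set $S=\{u,v,w\}$ satisfies $$2d(S) = d(u,v)+d(u,w)+d(v,w).$$
   Context: $d(u,v)$ is the shortest-path distance in $G$. For a nonempty $S\subseteq V(G)$, the Steiner distance $d(S)$ is the minimum number of edges among all connected subgraphs of $G$ whose vertex sets contain $S$. A median of a triple of vertices $u,v,w$ is a vertex $z$ (possibly one of $u,v,w$) lying on some shortest $u,v$-path, on some shortest $u,w$-path and on some shortest $v,w$-path. -}

module Defs where

open import Data.Nat using (ℕ; zero; suc; _+_; _≤_; _<ᵇ_)
open import Data.Bool using (Bool; true; false; _∧_; if_then_else_)
open import Data.Fin using (Fin; toℕ)
open import Data.List using (List; []; _∷_; map; allFin; concatMap)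
open import Data.Nat.ListAction using (sum)
open import Data.List.Membership.Propositional using (_∈_)
open import Data.Product using (Σ; ∃; _×_; _,_)
open import Data.Fin.Subset using (Subset)
  renaming (_∈_ to _∈ₛ_)
open import Relation.Binary.PropositionalEquality using (_≡_)
open import Relation.Nullary using (¬_)

record Graph : Set where
  field
    n     : ℕ
    adj   : Fin n → Fin n → Bool
    sym   : ∀ x y → adj x y ≡ adj y x
    irrefl : ∀ x → adj x x ≡ false
open Graph public

data Walk {m : ℕ} (E : Fin m → Fin m → Bool) : Fin m → Fin m → Set where
  [] : ∀ {x} → Walk E x x
  _∷_ : ∀ {x y z} → E x y ≡ true → Walk E y z → Walk E x z

len : ∀ {m} {E : Fin m → Fin m → Bool} {x y} → Walk E x y → ℕ
len [] = 0
len (_ ∷ p) = suc (len p)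

verts : ∀ {m} {E : Fin m → Fin m → Bool} {x y} → Walk E x y → List (Fin m)
verts {x = x} [] = x ∷ []
verts {x = x} (_ ∷ p) = x ∷ verts p

Connected : Graph → Set
Connected G = ∀ (x y : Fin (n G)) → Walk (adj G) x y

IsDist : (G : Graph) → Fin (n G) → Fin (n G) → ℕ → Set
IsDist G x y k =
  (Σ (Walk (adj G) x y) λ p → len p ≡ k) ×
  (∀ (p : Walk (adj G) x y) → k ≤ len p)

record Subgraph (G : Graph) : Set where
  field
    W      : Subset (n G)
    F      : Fin (n G) → Fin (n G) → Bool
    F-sym  : ∀ x y → F x y ≡ F y x
    F-adj  : ∀ x y → F x y ≡ true → adj G x y ≡ true
    F-W    : ∀ x y → F x y ≡ true → (x ∈ₛ W) × (y ∈ₛ W)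
open Subgraph public

edgeCount : (G : Graph) → Subgraph G → ℕ
edgeCount G H =
  sum (concatMap (λ x → map (λ y →
         if (toℕ x <ᵇ toℕ y) ∧ F H x y then 1 else 0)
       (allFin (n G))) (allFin (n G)))

SubConnected : (G : Graph) → Subgraph G → Set
SubConnected G H =
  ∀ x y → x ∈ₛ W H → y ∈ₛ W H → Walk (F H) x y

Contains : (G : Graph) → Subgraph G → Subset (n G) → Set
Contains G H S = ∀ x → x ∈ₛ S → x ∈ₛ W H

IsSteinerDist : (G : Graph) → Subset (n G) → ℕ → Set
IsSteinerDist G S k =
  (Σ (Subgraph G) λ H → SubConnected G H × Contains G H S × edgeCount G H ≡ k) ×
  (∀ (H : Subgraph G) → SubConnected G H → Contains G H S → k ≤ edgeCount G H)

OnGeodesic : (G : Graph) → Fin (n G) → Fin (n G) → Fin (n G) → Set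
OnGeodesic G x y z =
  Σ (Walk (adj G) x y) λ p →
    (∀ (q : Walk (adj G) x y) → len p ≤ len q) × (z ∈ verts p)

IsMedian : (G : Graph) → Fin (n G) → Fin (n G) → Fin (n G) → Fin (n G) → Set
IsMedian G x y w z = OnGeodesic G x y z × OnGeodesic G x w z × OnGeodesic G y w z

module Submission where

-- A star is a vertex c together with walks from c to u, v and w; its size is the sum of
-- their lengths. The edges of a star span a connected subgraph containing S, so d(S) is at
-- most its size. Conversely, in a connected subgraph containing S take a simple u–v path P
-- and a simple walk Q from w to its first vertex m on P: the edges of P and Q are distinct,
-- and they form a star centred at m. Hence d(S) is the least size of a star. By the
-- triangle inequality d(u,v) + d(u,w) + d(v,w) ≤ 2·size for every star, and equality forces
-- every two arms to form a geodesic, i.e. the centre to be a median; conversely a median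
-- with geodesic arms is a star whose size is exactly half of that sum.

open import Data.Bool using (Bool; true; false; T; _∧_; _∨_; if_then_else_)
open import Data.Bool.Properties using (T-≡; T-∧; T-∨; ∨-comm)
open import Data.Empty using (⊥-elim)
open import Data.Fin using (Fin; toℕ; _≟_)
open import Data.Fin.Properties using (toℕ-injective)
open import Data.Fin.Subset using (Subset; ⁅_⁆; _∪_) renaming (_∈_ to _∈ₛ_)
open import Data.Fin.Subset.Properties using (x∈⁅x⁆; x∈⁅y⁆⇒x≡y; x∈p∪q⁺; x∈p∪q⁻)
open import Data.List using (List; []; _∷_; _++_; length; map; concatMap; filterᵇ; cartesianProduct; allFin)
open import Data.List.Membership.Propositional using (_∈_; _∉_; find; lose)
open import Data.List.Membership.Propositional.Properties
  using (∈-map⁺; ∈-map⁻; ∈-filter⁺; ∈-filter⁻; ∈-cartesianProduct⁺; ∈-allFin)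
open import Data.List.Properties using (length-removeAt′; length-map; length-++; map-∘; map-++)
open import Data.List.Relation.Binary.Subset.Propositional using (_⊆_)
open import Data.List.Relation.Unary.All as All using (All; []; _∷_)
open import Data.List.Relation.Unary.All.Properties using (++⁺)
open import Data.List.Relation.Unary.AllPairs using (AllPairs; []; _∷_)
import Data.List.Relation.Unary.AllPairs.Properties as AllPairs
open import Data.List.Relation.Unary.Any using (here; there; index; _─_)
import Data.List.Relation.Unary.Any.Properties as Any
open import Data.List.Relation.Unary.Unique.Propositional using (Unique)
import Data.List.Relation.Unary.Unique.Propositional.Properties as Unique
open import Data.Nat using (ℕ; suc; _+_; _*_; _≤_; _<ᵇ_; z≤n; s≤s)
open import Data.Nat.ListAction using (sum)
open import Data.Nat.Properties
  using ( +-comm; +-assoc; +-identityʳ; +-mono-≤; +-monoˡ-≤; +-monoʳ-≤; *-monoʳ-≤; +-cancelˡ-≤; +-cancelʳ-≤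
        ; ≤-trans; ≤-reflexive; ≤-antisym; <⇒<ᵇ; <ᵇ⇒<; <-asym; ≤∧≢⇒<; ≮⇒≥; module ≤-Reasoning )
open import Data.Nat.Solver using (module +-*-Solver)
open import Data.Product using (Σ; ∃; ∃-syntax; _×_; _,_; proj₁; proj₂; swap)
open import Data.Product.Properties using (≡-dec)
open import Data.Sum using (_⊎_; inj₁; inj₂)
open import Data.Vec using (tabulate)
open import Data.Vec.Properties using (lookup∘tabulate; lookup⇒[]=; []=⇒lookup)
open import Function using (id; _∘_; case_of_)
open import Function.Bundles using (Equivalence; _⇔_; mk⇔)
open import Relation.Binary.PropositionalEquality
open import Relation.Nullary using (yes; no)
open import Relation.Nullary.Decidable using (T?; ⌊_⌋; toWitness; fromWitness)

open import Defs renaming (sym to adj-sym)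

open Equivalence using (to; from)

∈-─ : ∀ {A : Set} {x y : A} {ys : List A} (x∈ys : x ∈ ys) → y ∈ ys → x ≢ y → y ∈ (ys ─ x∈ys)
∈-─ (here refl) (here refl) x≢y = ⊥-elim (x≢y refl)
∈-─ (here _) (there y∈ys) _ = y∈ys
∈-─ (there _) (here refl) _ = here refl
∈-─ (there x∈ys) (there y∈ys) x≢y = there (∈-─ x∈ys y∈ys x≢y)

Unique-⊆⇒length-≤ : ∀ {A : Set} {xs ys : List A} → Unique xs → xs ⊆ ys → length xs ≤ length ys
Unique-⊆⇒length-≤ [] _ = z≤n
Unique-⊆⇒length-≤ {xs = x ∷ xs} {ys} (x∉xs ∷ xs!) xs⊆ys = begin
  suc (length xs)          ≤⟨ s≤s (Unique-⊆⇒length-≤ xs! xs⊆ys─x) ⟩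
  suc (length (ys ─ x∈ys)) ≡⟨ sym (length-removeAt′ ys (index x∈ys)) ⟩
  length ys                ∎
  where
  open ≤-Reasoning
  x∈ys : x ∈ ys
  x∈ys = xs⊆ys (here refl)
  xs⊆ys─x : xs ⊆ (ys ─ x∈ys)
  xs⊆ys─x y∈xs = ∈-─ x∈ys (xs⊆ys (there y∈xs)) (All.lookup x∉xs y∈xs)

∈-concatMap⁺ : ∀ {A B : Set} (f : A → List B) {a x xs} → a ∈ xs → x ∈ f a → x ∈ concatMap f xs
∈-concatMap⁺ f a∈xs x∈fa = Any.concatMap⁺ f (lose a∈xs x∈fa)

∈-concatMap⁻ : ∀ {A B : Set} (f : A → List B) {x} xs → x ∈ concatMap f xs → ∃[ a ] a ∈ xs × x ∈ f a
∈-concatMap⁻ f xs x∈ = find (Any.concatMap⁻ f {xs = xs} x∈)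

concatMap-map≡map-cartesianProduct : ∀ {A B C : Set} (g : A × B → C) (xs : List A) (ys : List B) →
  concatMap (λ x → map (λ y → g (x , y)) ys) xs ≡ map g (cartesianProduct xs ys)
concatMap-map≡map-cartesianProduct g [] ys = refl
concatMap-map≡map-cartesianProduct g (x ∷ xs) ys = begin
  map (λ y → g (x , y)) ys ++ concatMap (λ x → map (λ y → g (x , y)) ys) xs
    ≡⟨ cong₂ _++_ (map-∘ ys) (concatMap-map≡map-cartesianProduct g xs ys) ⟩
  map g (map (x ,_) ys) ++ map g (cartesianProduct xs ys)
    ≡⟨ sym (map-++ g (map (x ,_) ys) _) ⟩
  map g (cartesianProduct (x ∷ xs) ys) ∎
  where open ≡-Reasoning

sum-indicator≡length-filterᵇ : ∀ {A : Set} (b : A → Bool) (xs : List A) →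
  sum (map (λ a → if b a then 1 else 0) xs) ≡ length (filterᵇ b xs)
sum-indicator≡length-filterᵇ b [] = refl
sum-indicator≡length-filterᵇ b (x ∷ xs) with b x
... | true = cong suc (sum-indicator≡length-filterᵇ b xs)
... | false = sum-indicator≡length-filterᵇ b xs

squeeze : ∀ {x x′ y y′} → x ≤ x′ → y ≤ y′ → x′ + y′ ≤ x + y → x′ ≤ x × y′ ≤ y
squeeze {x} {x′} {y} {y′} x≤x′ y≤y′ sum≤ =
  +-cancelʳ-≤ y′ x′ x (≤-trans sum≤ (+-monoʳ-≤ x y≤y′)) ,
  +-cancelˡ-≤ x′ y′ y (≤-trans sum≤ (+-monoˡ-≤ y x≤x′))

squeeze₃ : ∀ {x x′ y y′ z z′} → x ≤ x′ → y ≤ y′ → z ≤ z′ → x′ + y′ + z′ ≤ x + y + z →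
  x′ ≤ x × y′ ≤ y × z′ ≤ z
squeeze₃ x≤x′ y≤y′ z≤z′ sum≤ =
  let xy , z = squeeze (+-mono-≤ x≤x′ y≤y′) z≤z′ sum≤
      x , y = squeeze x≤x′ y≤y′ xy
  in x , y , z

double-sum≡pairwise : ∀ a b c → 2 * (a + b + c) ≡ (a + b) + (a + c) + (b + c)
double-sum≡pairwise = solve 3 (λ a b c → con 2 :* (a :+ b :+ c) := (a :+ b) :+ (a :+ c) :+ (b :+ c)) refl
  where open +-*-Solver

∈-triple⁺ : ∀ {k} {x u v w : Fin k} → x ≡ u ⊎ x ≡ v ⊎ x ≡ w → x ∈ₛ ⁅ u ⁆ ∪ ⁅ v ⁆ ∪ ⁅ w ⁆
∈-triple⁺ (inj₁ refl) = x∈p∪q⁺ (inj₁ (x∈⁅x⁆ _))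
∈-triple⁺ {u = u} (inj₂ (inj₁ refl)) = x∈p∪q⁺ {p = ⁅ u ⁆} (inj₂ (x∈p∪q⁺ (inj₁ (x∈⁅x⁆ _))))
∈-triple⁺ {u = u} {v} (inj₂ (inj₂ refl)) = x∈p∪q⁺ {p = ⁅ u ⁆} (inj₂ (x∈p∪q⁺ {p = ⁅ v ⁆} (inj₂ (x∈⁅x⁆ _))))

∈-triple⁻ : ∀ {k} {x u v w : Fin k} → x ∈ₛ ⁅ u ⁆ ∪ ⁅ v ⁆ ∪ ⁅ w ⁆ → x ≡ u ⊎ x ≡ v ⊎ x ≡ w
∈-triple⁻ {u = u} {v} {w} x∈ with x∈p∪q⁻ ⁅ u ⁆ _ x∈
... | inj₁ x∈u = inj₁ (x∈⁅y⁆⇒x≡y u x∈u)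
... | inj₂ x∈vw with x∈p∪q⁻ ⁅ v ⁆ ⁅ w ⁆ x∈vw
...   | inj₁ x∈v = inj₂ (inj₁ (x∈⁅y⁆⇒x≡y v x∈v))
...   | inj₂ x∈w = inj₂ (inj₂ (x∈⁅y⁆⇒x≡y w x∈w))

EdgeIn : ∀ {m} → (Fin m → Fin m → Bool) → Fin m × Fin m → Set
EdgeIn E (x , y) = E x y ≡ true

module _ {m : ℕ} {E : Fin m → Fin m → Bool} where

  open import Data.List.Membership.DecPropositional (_≟_ {m}) using (_∈?_)

  infixr 5 _++ʷ_
  _++ʷ_ : ∀ {x y z} → Walk E x y → Walk E y z → Walk E x z
  [] ++ʷ q = q
  (e ∷ p) ++ʷ q = e ∷ (p ++ʷ q)

  len-++ʷ : ∀ {x y z} (p : Walk E x y) (q : Walk E y z) → len (p ++ʷ q) ≡ len p + len q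
  len-++ʷ [] q = refl
  len-++ʷ (e ∷ p) q = cong suc (len-++ʷ p q)

  head∈verts : ∀ {x y} (p : Walk E x y) → x ∈ verts p
  head∈verts [] = here refl
  head∈verts (e ∷ p) = here refl

  last∈verts : ∀ {x y} (p : Walk E x y) → y ∈ verts p
  last∈verts [] = here refl
  last∈verts (e ∷ p) = there (last∈verts p)

  ∈verts-++ʷʳ : ∀ {x y z t} (p : Walk E x y) (q : Walk E y z) → t ∈ verts q → t ∈ verts (p ++ʷ q)
  ∈verts-++ʷʳ [] q t∈q = t∈q
  ∈verts-++ʷʳ (e ∷ p) q t∈q = there (∈verts-++ʷʳ p q t∈q)

  splitAt : ∀ {x y z} (p : Walk E x y) → z ∈ verts p →
    Σ (Walk E x z) λ p₁ → Σ (Walk E z y) λ p₂ → len p₁ + len p₂ ≡ len p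
  splitAt [] (here refl) = [] , [] , refl
  splitAt (e ∷ p) (here refl) = [] , e ∷ p , refl
  splitAt (e ∷ p) (there z∈p) =
    let p₁ , p₂ , eq = splitAt p z∈p in e ∷ p₁ , p₂ , cong suc eq

  edges : ∀ {x y} → Walk E x y → List (Fin m × Fin m)
  edges [] = []
  edges (_∷_ {x} {y} _ p) = (x , y) ∷ edges p

  length-edges : ∀ {x y} (p : Walk E x y) → length (edges p) ≡ len p
  length-edges [] = refl
  length-edges (e ∷ p) = cong suc (length-edges p)

  edges-adjacent : ∀ {x y} (p : Walk E x y) → All (EdgeIn E) (edges p)
  edges-adjacent [] = []
  edges-adjacent (e ∷ p) = e ∷ edges-adjacent p

  ∈edges⇒∈verts : ∀ {x y e} (p : Walk E x y) → e ∈ edges p → proj₁ e ∈ verts p × proj₂ e ∈ verts p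
  ∈edges⇒∈verts (e ∷ p) (here refl) = here refl , there (head∈verts p)
  ∈edges⇒∈verts (e ∷ p) (there e∈p) = let a , b = ∈edges⇒∈verts p e∈p in there a , there b

  prefixTo : ∀ {E′ : Fin m → Fin m → Bool} {x y t} (p : Walk E x y) →
    All (EdgeIn E′) (edges p) → t ∈ verts p → Walk E′ x t
  prefixTo [] _ (here refl) = []
  prefixTo (e ∷ p) _ (here refl) = []
  prefixTo (e ∷ p) (e′ ∷ es) (there t∈p) = e′ ∷ prefixTo p es t∈p

  data Simple : ∀ {x y} → Walk E x y → Set where
    [] : ∀ {x} → Simple ([] {x = x})
    _∷_ : ∀ {x y z} {e : E x y ≡ true} {p : Walk E y z} → x ∉ verts p → Simple p → Simple (e ∷ p)

  suffixFrom : ∀ {x y z} (p : Walk E x y) → z ∈ verts p → Simple p → Σ (Walk E z y) Simple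
  suffixFrom [] (here refl) p! = [] , p!
  suffixFrom (e ∷ p) (here refl) p! = e ∷ p , p!
  suffixFrom (e ∷ p) (there z∈p) (_ ∷ p!) = suffixFrom p z∈p p!

  simplify : ∀ {x y} → Walk E x y → Σ (Walk E x y) Simple
  simplify [] = [] , []
  simplify (_∷_ {x} e p) with simplify p
  ... | q , q! with x ∈? verts q
  ...   | yes x∈q = suffixFrom q x∈q q!
  ...   | no x∉q = e ∷ q , x∉q ∷ q!

  firstHit : ∀ {x y} (Ps : List (Fin m)) (r : Walk E x y) → Simple r → y ∈ Ps →
    ∃[ z ] Σ (Walk E x z) λ q →
      z ∈ Ps × Simple q × All (λ e → proj₁ e ∉ Ps) (edges q) × verts q ⊆ verts r
  firstHit Ps [] [] y∈Ps = _ , [] , y∈Ps , [] , [] , id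
  firstHit {x} Ps (e ∷ r) (x∉r ∷ r!) y∈Ps with x ∈? Ps
  ... | yes x∈Ps = x , [] , x∈Ps , [] , [] , λ { (here refl) → here refl ; (there ()) }
  ... | no x∉Ps =
    let z , q , z∈Ps , q! , q-avoids , q⊆r = firstHit Ps r r! y∈Ps
    in z , e ∷ q , z∈Ps , (x∉r ∘ q⊆r) ∷ q! , x∉Ps ∷ q-avoids ,
       λ { (here refl) → here refl ; (there t∈q) → there (q⊆r t∈q) }

  mapʷ : ∀ {E′ : Fin m → Fin m → Bool} → (∀ {a b} → E a b ≡ true → E′ a b ≡ true) →
    ∀ {x y} → Walk E x y → Walk E′ x y
  mapʷ f [] = []
  mapʷ f (e ∷ p) = f e ∷ mapʷ f p

  len-mapʷ : ∀ {E′ : Fin m → Fin m → Bool} (f : ∀ {a b} → E a b ≡ true → E′ a b ≡ true) →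
    ∀ {x y} (p : Walk E x y) → len (mapʷ f p) ≡ len p
  len-mapʷ f [] = refl
  len-mapʷ f (e ∷ p) = cong suc (len-mapʷ f p)

module _ {m : ℕ} {E : Fin m → Fin m → Bool} (E-sym : ∀ x y → E x y ≡ E y x) where

  reverseʷ : ∀ {x y} → Walk E x y → Walk E y x
  reverseʷ [] = []
  reverseʷ (_∷_ {x} {y} e p) = reverseʷ p ++ʷ (trans (E-sym y x) e ∷ [])

  len-reverseʷ : ∀ {x y} (p : Walk E x y) → len (reverseʷ p) ≡ len p
  len-reverseʷ [] = refl
  len-reverseʷ (e ∷ p) = trans (len-++ʷ (reverseʷ p) _) (trans (+-comm _ 1) (cong suc (len-reverseʷ p)))

-- An unordered edge {a, b} is represented by its endpoints in increasing order, the
-- orientation that edgeCount counts.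
canonical : ∀ {k} → Fin k × Fin k → Fin k × Fin k
canonical (a , b) = if toℕ a <ᵇ toℕ b then (a , b) else (b , a)

canonical≡id⊎swap : ∀ {k} (e : Fin k × Fin k) → canonical e ≡ e ⊎ canonical e ≡ swap e
canonical≡id⊎swap (a , b) with toℕ a <ᵇ toℕ b
... | true = inj₁ refl
... | false = inj₂ refl

canonical-injective : ∀ {k} {e e′ : Fin k × Fin k} → canonical e ≡ canonical e′ → e ≡ e′ ⊎ e ≡ swap e′
canonical-injective {e = e} {e′} eq with canonical≡id⊎swap e | canonical≡id⊎swap e′
... | inj₁ p | inj₁ q = inj₁ (trans (sym p) (trans eq q))
... | inj₁ p | inj₂ q = inj₂ (trans (sym p) (trans eq q))
... | inj₂ p | inj₁ q = inj₂ (cong swap (trans (sym p) (trans eq q)))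
... | inj₂ p | inj₂ q = inj₁ (cong swap (trans (sym p) (trans eq q)))

canonical-ordered : ∀ {k} {a b : Fin k} → T (toℕ a <ᵇ toℕ b) → canonical (a , b) ≡ (a , b)
canonical-ordered {a = a} {b} a<b with toℕ a <ᵇ toℕ b
... | true = refl

canonical-reversed : ∀ {k} {a b : Fin k} → T (toℕ a <ᵇ toℕ b) → canonical (b , a) ≡ (a , b)
canonical-reversed {a = a} {b} a<b with toℕ b <ᵇ toℕ a in b<a
... | false = refl
... | true = ⊥-elim (<-asym (<ᵇ⇒< (toℕ a) (toℕ b) a<b) (<ᵇ⇒< (toℕ b) (toℕ a) (from T-≡ b<a)))

canonical-<ᵇ : ∀ {k} {a b : Fin k} → a ≢ b →
  T (toℕ (proj₁ (canonical (a , b))) <ᵇ toℕ (proj₂ (canonical (a , b))))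
canonical-<ᵇ {a = a} {b} a≢b with toℕ a <ᵇ toℕ b in a<b
... | true = from T-≡ a<b
... | false = <⇒<ᵇ (≤∧≢⇒< (≮⇒≥ (λ lt → subst T a<b (<⇒<ᵇ lt))) (λ eq → a≢b (toℕ-injective (sym eq))))

DistinctEdges : ∀ {k} → Fin k × Fin k → Fin k × Fin k → Set
DistinctEdges e e′ = canonical e ≢ canonical e′

distinctEdges : ∀ {k} {e e′ : Fin k × Fin k} → proj₁ e ≢ proj₁ e′ → proj₁ e ≢ proj₂ e′ → DistinctEdges e e′
distinctEdges ne₁ ne₂ eq with canonical-injective eq
... | inj₁ refl = ne₁ refl
... | inj₂ refl = ne₂ refl

module _ {m : ℕ} {E : Fin m → Fin m → Bool} where

  ∉verts⇒distinctEdges : ∀ {x y} {e : Fin m × Fin m} (p : Walk E x y) → proj₁ e ∉ verts p →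
    All (DistinctEdges e) (edges p)
  ∉verts⇒distinctEdges p e∉p = All.tabulate λ e′∈p →
    let a , b = ∈edges⇒∈verts p e′∈p in
    distinctEdges (λ eq → e∉p (subst (_∈ verts p) (sym eq) a)) (λ eq → e∉p (subst (_∈ verts p) (sym eq) b))

  simple⇒distinctEdges : ∀ {x y} {p : Walk E x y} → Simple p → AllPairs DistinctEdges (edges p)
  simple⇒distinctEdges [] = []
  simple⇒distinctEdges {p = _ ∷ p} (x∉p ∷ p!) = ∉verts⇒distinctEdges p x∉p ∷ simple⇒distinctEdges p!

module _ (G : Graph) where

  isOrderedEdge : Subgraph G → Fin (n G) × Fin (n G) → Bool
  isOrderedEdge H (x , y) = (toℕ x <ᵇ toℕ y) ∧ F H x y

  edgeList : Subgraph G → List (Fin (n G) × Fin (n G))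
  edgeList H = filterᵇ (isOrderedEdge H) (cartesianProduct (allFin (n G)) (allFin (n G)))

  edgeCount≡length-edgeList : ∀ H → edgeCount G H ≡ length (edgeList H)
  edgeCount≡length-edgeList H = trans
    (cong sum (concatMap-map≡map-cartesianProduct (λ e → if isOrderedEdge H e then 1 else 0) vs vs))
    (sum-indicator≡length-filterᵇ (isOrderedEdge H) (cartesianProduct vs vs))
    where vs = allFin (n G)

  edgeList-unique : ∀ H → Unique (edgeList H)
  edgeList-unique H = Unique.filter⁺ _ (Unique.cartesianProduct⁺ (Unique.allFin⁺ _) (Unique.allFin⁺ _))

  ∈-edgeList⁺ : ∀ {H e} → T (isOrderedEdge H e) → e ∈ edgeList H
  ∈-edgeList⁺ {e = x , y} edge = ∈-filter⁺ _ (∈-cartesianProduct⁺ (∈-allFin x) (∈-allFin y)) edge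

  ∈-edgeList⁻ : ∀ {H e} → e ∈ edgeList H → T (toℕ (proj₁ e) <ᵇ toℕ (proj₂ e)) × EdgeIn (F H) e
  ∈-edgeList⁻ {H} e∈ =
    let lt , edge = to T-∧ (proj₂ (∈-filter⁻ (T? ∘ isOrderedEdge H) {xs = cartesianProduct vs vs} e∈))
    in lt , to T-≡ edge
    where vs = allFin (n G)

  canonical-isOrderedEdge : ∀ {H e} → EdgeIn (F H) e → T (isOrderedEdge H (canonical e))
  canonical-isOrderedEdge {H} {a , b} Fab =
    from T-∧ (canonical-<ᵇ a≢b , from T-≡ (canonical-F (canonical≡id⊎swap (a , b))))
    where
    a≢b : a ≢ b
    a≢b refl = case trans (sym (F-adj H a a Fab)) (irrefl G a) of λ ()
    canonical-F : canonical (a , b) ≡ (a , b) ⊎ canonical (a , b) ≡ (b , a) →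
      EdgeIn (F H) (canonical (a , b))
    canonical-F (inj₁ eq) rewrite eq = Fab
    canonical-F (inj₂ eq) rewrite eq = trans (F-sym H b a) Fab

  distinctEdges⇒length-≤-edgeCount : ∀ H (L : List (Fin (n G) × Fin (n G))) →
    All (EdgeIn (F H)) L → AllPairs DistinctEdges L → length L ≤ edgeCount G H
  distinctEdges⇒length-≤-edgeCount H L L⊆H L! = begin
    length L                 ≡⟨ sym (length-map canonical L) ⟩
    length (map canonical L) ≤⟨ Unique-⊆⇒length-≤ (AllPairs.map⁺ L!) canonical-L⊆edgeList ⟩
    length (edgeList H)      ≡⟨ sym (edgeCount≡length-edgeList H) ⟩
    edgeCount G H            ∎
    where
    open ≤-Reasoning
    canonical-L⊆edgeList : map canonical L ⊆ edgeList H
    canonical-L⊆edgeList e′∈ with ∈-map⁻ canonical e′∈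
    ... | e , e∈L , refl = ∈-edgeList⁺ {H} (canonical-isOrderedEdge {H} {e} (All.lookup L⊆H e∈L))

  simple-avoiding-≤-edgeCount : ∀ (H : Subgraph G) {a b c d} {P : Walk (F H) a b} {Q : Walk (F H) c d} →
    Simple P → Simple Q → All (λ e → proj₁ e ∉ verts P) (edges Q) → len Q + len P ≤ edgeCount G H
  simple-avoiding-≤-edgeCount H {P = P} {Q} P! Q! Q-avoids-P = begin
    len Q + len P                       ≡⟨ sym (cong₂ _+_ (length-edges Q) (length-edges P)) ⟩
    length (edges Q) + length (edges P) ≡⟨ sym (length-++ (edges Q)) ⟩
    length (edges Q ++ edges P)         ≤⟨ distinctEdges⇒length-≤-edgeCount H _ edges⊆H distinct ⟩
    edgeCount G H                       ∎
    where
    open ≤-Reasoning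
    edges⊆H : All (EdgeIn (F H)) (edges Q ++ edges P)
    edges⊆H = ++⁺ (edges-adjacent Q) (edges-adjacent P)
    distinct : AllPairs DistinctEdges (edges Q ++ edges P)
    distinct = AllPairs.++⁺ (simple⇒distinctEdges Q!) (simple⇒distinctEdges P!)
      (All.map (∉verts⇒distinctEdges P) Q-avoids-P)

module _ {k : ℕ} where

  open import Data.List.Membership.DecPropositional (_≟_ {k}) using (_∈?_)
  open import Data.List.Membership.DecPropositional (≡-dec (_≟_ {k}) (_≟_ {k}))
    using () renaming (_∈?_ to _∈ᵉ?_)

  fromList : List (Fin k) → Subset k
  fromList xs = tabulate (λ x → ⌊ x ∈? xs ⌋)

  ∈-fromList⁺ : ∀ {x xs} → x ∈ xs → x ∈ₛ fromList xs
  ∈-fromList⁺ {x} {xs} x∈xs = lookup⇒[]= x _ (trans (lookup∘tabulate _ x) (to T-≡ (fromWitness x∈xs)))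

  ∈-fromList⁻ : ∀ {x xs} → x ∈ₛ fromList xs → x ∈ xs
  ∈-fromList⁻ {x} {xs} x∈ₛ = toWitness (from T-≡ (trans (sym (lookup∘tabulate _ x)) ([]=⇒lookup x∈ₛ)))

  symClosure : List (Fin k × Fin k) → Fin k → Fin k → Bool
  symClosure L x y = ⌊ (x , y) ∈ᵉ? L ⌋ ∨ ⌊ (y , x) ∈ᵉ? L ⌋

  symClosure-sym : ∀ L x y → symClosure L x y ≡ symClosure L y x
  symClosure-sym L x y = ∨-comm ⌊ (x , y) ∈ᵉ? L ⌋ ⌊ (y , x) ∈ᵉ? L ⌋

  symClosure⁺ : ∀ {L e} → e ∈ L → EdgeIn (symClosure L) e
  symClosure⁺ {L} {e} e∈L = to T-≡ (from (T-∨ {⌊ e ∈ᵉ? L ⌋}) (inj₁ (fromWitness e∈L)))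

  symClosure⁻ : ∀ {L x y} → symClosure L x y ≡ true → (x , y) ∈ L ⊎ (y , x) ∈ L
  symClosure⁻ {L} {x} {y} xy with to (T-∨ {⌊ (x , y) ∈ᵉ? L ⌋}) (from T-≡ xy)
  ... | inj₁ t = inj₁ (toWitness t)
  ... | inj₂ t = inj₂ (toWitness t)

module _ (G : Graph) where

  spannedBy : (Vs : List (Fin (n G))) (L : List (Fin (n G) × Fin (n G))) →
    All (EdgeIn (adj G)) L → All (λ e → proj₁ e ∈ Vs × proj₂ e ∈ Vs) L →
    Subgraph G
  spannedBy Vs L L⊆G L⊆Vs = record
    { W = fromList Vs
    ; F = symClosure L
    ; F-sym = symClosure-sym L
    ; F-adj = λ x y xy → case symClosure⁻ xy of λ
        { (inj₁ xy∈L) → All.lookup L⊆G xy∈L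
        ; (inj₂ yx∈L) → trans (adj-sym G x y) (All.lookup L⊆G yx∈L) }
    ; F-W = λ x y xy → case symClosure⁻ xy of λ
        { (inj₁ xy∈L) → let x∈ , y∈ = All.lookup L⊆Vs xy∈L in ∈-fromList⁺ x∈ , ∈-fromList⁺ y∈
        ; (inj₂ yx∈L) → let y∈ , x∈ = All.lookup L⊆Vs yx∈L in ∈-fromList⁺ x∈ , ∈-fromList⁺ y∈ }
    }

  edgeCount-spannedBy-≤ : ∀ Vs L L⊆G L⊆Vs → edgeCount G (spannedBy Vs L L⊆G L⊆Vs) ≤ length L
  edgeCount-spannedBy-≤ Vs L L⊆G L⊆Vs = begin
    edgeCount G H            ≡⟨ edgeCount≡length-edgeList G H ⟩
    length (edgeList G H)    ≤⟨ Unique-⊆⇒length-≤ (edgeList-unique G H) edgeList⊆canonical-L ⟩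
    length (map canonical L) ≡⟨ length-map canonical L ⟩
    length L                 ∎
    where
    open ≤-Reasoning
    H : Subgraph G
    H = spannedBy Vs L L⊆G L⊆Vs
    edgeList⊆canonical-L : edgeList G H ⊆ map canonical L
    edgeList⊆canonical-L {x , y} xy∈ with ∈-edgeList⁻ G {H} xy∈
    ... | x<y , xy with symClosure⁻ {L = L} xy
    ...   | inj₁ xy∈L = subst (_∈ map canonical L) (canonical-ordered x<y) (∈-map⁺ canonical xy∈L)
    ...   | inj₂ yx∈L = subst (_∈ map canonical L) (canonical-reversed x<y) (∈-map⁺ canonical yx∈L)

module _ (G : Graph) {c : Fin (n G)} (arms : List (∃ (Walk (adj G) c))) where

  armVerts : List (Fin (n G))
  armVerts = concatMap (verts ∘ proj₂) arms

  armEdges : List (Fin (n G) × Fin (n G))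
  armEdges = concatMap (edges ∘ proj₂) arms

  length-armEdges : length armEdges ≡ sum (map (len ∘ proj₂) arms)
  length-armEdges = go arms
    where
    go : ∀ ps → length (concatMap (edges ∘ proj₂) ps) ≡ sum (map (len ∘ proj₂) ps)
    go [] = refl
    go ((_ , p) ∷ ps) = trans (length-++ (edges p)) (cong₂ _+_ (length-edges p) (go ps))

  armEdges⊆G : All (EdgeIn (adj G)) armEdges
  armEdges⊆G = All.tabulate λ e∈ →
    let (_ , p) , _ , e∈p = ∈-concatMap⁻ (edges ∘ proj₂) arms e∈ in All.lookup (edges-adjacent p) e∈p

  armEdges⊆armVerts : All (λ e → proj₁ e ∈ armVerts × proj₂ e ∈ armVerts) armEdges
  armEdges⊆armVerts = All.tabulate λ e∈ →
    let (_ , p) , p∈arms , e∈p = ∈-concatMap⁻ (edges ∘ proj₂) arms e∈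
        a , b = ∈edges⇒∈verts p e∈p
    in ∈-concatMap⁺ (verts ∘ proj₂) p∈arms a , ∈-concatMap⁺ (verts ∘ proj₂) p∈arms b

  walkUnion : Subgraph G
  walkUnion = spannedBy G armVerts armEdges armEdges⊆G armEdges⊆armVerts

  walkUnion-connected : SubConnected G walkUnion
  walkUnion-connected x y x∈ y∈ = reverseʷ (F-sym walkUnion) (fromCentre x∈) ++ʷ fromCentre y∈
    where
    fromCentre : ∀ {t} → t ∈ₛ W walkUnion → Walk (F walkUnion) c t
    fromCentre t∈ =
      let (_ , p) , p∈arms , t∈p = ∈-concatMap⁻ (verts ∘ proj₂) arms (∈-fromList⁻ t∈)
      in prefixTo p (All.tabulate λ e∈p → symClosure⁺ (∈-concatMap⁺ (edges ∘ proj₂) p∈arms e∈p)) t∈p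

  armEnd∈walkUnion : ∀ {y} {p : Walk (adj G) c y} → (y , p) ∈ arms → y ∈ₛ W walkUnion
  armEnd∈walkUnion {p = p} p∈arms = ∈-fromList⁺ (∈-concatMap⁺ (verts ∘ proj₂) p∈arms (last∈verts p))

  edgeCount-walkUnion-≤ : edgeCount G walkUnion ≤ sum (map (len ∘ proj₂) arms)
  edgeCount-walkUnion-≤ = ≤-trans
    (edgeCount-spannedBy-≤ G armVerts armEdges armEdges⊆G armEdges⊆armVerts) (≤-reflexive length-armEdges)

module _ (G : Graph) where

  joinAt : ∀ {c x y} → Walk (adj G) c x → Walk (adj G) c y → Walk (adj G) x y
  joinAt a b = reverseʷ (adj-sym G) a ++ʷ b

  len-joinAt : ∀ {c x y} (a : Walk (adj G) c x) (b : Walk (adj G) c y) → len (joinAt a b) ≡ len a + len b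
  len-joinAt a b = trans (len-++ʷ (reverseʷ (adj-sym G) a) b) (cong (_+ len b) (len-reverseʷ (adj-sym G) a))

  IsDist-unique : ∀ {x y d d′} → IsDist G x y d → IsDist G x y d′ → d ≡ d′
  IsDist-unique ((p , refl) , p-min) ((p′ , refl) , p′-min) = ≤-antisym (p-min p′) (p′-min p)

  IsDist-sym : ∀ {x y d} → IsDist G x y d → IsDist G y x d
  IsDist-sym ((p , refl) , p-min) =
    (reverseʷ (adj-sym G) p , len-reverseʷ (adj-sym G) p) ,
    λ q → subst (len p ≤_) (len-reverseʷ (adj-sym G) q) (p-min (reverseʷ (adj-sym G) q))

  dist-≤-joinAt : ∀ {c x y d} → IsDist G x y d → (a : Walk (adj G) c x) (b : Walk (adj G) c y) →
    d ≤ len a + len b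
  dist-≤-joinAt (_ , d-min) a b = subst (_ ≤_) (len-joinAt a b) (d-min (joinAt a b))

  joinAt-onGeodesic : ∀ {c x y d} → IsDist G x y d → (a : Walk (adj G) c x) (b : Walk (adj G) c y) →
    len a + len b ≤ d → OnGeodesic G x y c
  joinAt-onGeodesic (_ , d-min) a b short =
    joinAt a b ,
    (λ q → ≤-trans (≤-reflexive (len-joinAt a b)) (≤-trans short (d-min q))) ,
    ∈verts-++ʷʳ (reverseʷ (adj-sym G) a) b (head∈verts b)

  onGeodesic-split : ∀ {x y z d} → IsDist G x y d → OnGeodesic G x y z →
    ∃[ d₁ ] ∃[ d₂ ] IsDist G x z d₁ × IsDist G z y d₂ × d₁ + d₂ ≡ d
  onGeodesic-split ((p₀ , refl) , d-min) (p , p-min , z∈p) with splitAt p z∈p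
  ... | p₁ , p₂ , len-p =
    len p₁ , len p₂ ,
    ((p₁ , refl) , λ q → +-cancelʳ-≤ (len p₂) _ _ (subst (_ ≤_) (len-++ʷ q p₂) (shortest (q ++ʷ p₂)))) ,
    ((p₂ , refl) , λ q → +-cancelˡ-≤ (len p₁) _ _ (subst (_ ≤_) (len-++ʷ p₁ q) (shortest (p₁ ++ʷ q)))) ,
    trans len-p (≤-antisym (p-min p₀) (d-min p))
    where
    shortest : (q : Walk (adj G) _ _) → len p₁ + len p₂ ≤ len q
    shortest q = subst (_≤ len q) (sym len-p) (p-min q)

record Star (G : Graph) (u v w : Fin (n G)) : Set where
  constructor star
  field
    {centre} : Fin (n G)
    toU : Walk (adj G) centre u
    toV : Walk (adj G) centre v
    toW : Walk (adj G) centre w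

  size : ℕ
  size = len toU + len toV + len toW

open Star

module _ (G : Graph) {u v w : Fin (n G)} where

  steiner-≤-size : ∀ {dS} → IsSteinerDist G (⁅ u ⁆ ∪ ⁅ v ⁆ ∪ ⁅ w ⁆) dS → (s : Star G u v w) → dS ≤ size s
  steiner-≤-size {dS} (_ , minimal) s = begin
    dS                               ≤⟨ minimal H (walkUnion-connected G arms) S⊆H ⟩
    edgeCount G H                    ≤⟨ edgeCount-walkUnion-≤ G arms ⟩
    len (toU s) + (len (toV s) + (len (toW s) + 0))
      ≡⟨ cong (λ k → len (toU s) + (len (toV s) + k)) (+-identityʳ _) ⟩
    len (toU s) + (len (toV s) + len (toW s)) ≡⟨ sym (+-assoc (len (toU s)) _ _) ⟩
    size s                           ∎
    where
    open ≤-Reasoning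
    arms : List (∃ (Walk (adj G) (centre s)))
    arms = (u , toU s) ∷ (v , toV s) ∷ (w , toW s) ∷ []
    H : Subgraph G
    H = walkUnion G arms
    S⊆H : Contains G H (⁅ u ⁆ ∪ ⁅ v ⁆ ∪ ⁅ w ⁆)
    S⊆H x x∈ with ∈-triple⁻ x∈
    ... | inj₁ refl = armEnd∈walkUnion G arms (here refl)
    ... | inj₂ (inj₁ refl) = armEnd∈walkUnion G arms (there (here refl))
    ... | inj₂ (inj₂ refl) = armEnd∈walkUnion G arms (there (there (here refl)))

  branchStar : ∀ (H : Subgraph G) {m} (P : Walk (F H) u v) → m ∈ verts P → (Q : Walk (F H) w m) →
    Σ (Star G u v w) λ s → size s ≡ len P + len Q
  branchStar H P m∈P Q with splitAt P m∈P
  ... | P₁ , P₂ , len-P =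
    star (toG (reverseʷ (F-sym H) P₁)) (toG P₂) (toG (reverseʷ (F-sym H) Q)) ,
    (begin
      len (toG (reverseʷ (F-sym H) P₁)) + len (toG P₂) + len (toG (reverseʷ (F-sym H) Q))
        ≡⟨ cong₂ _+_ (cong₂ _+_ (len-toG-reverse P₁) (len-toG P₂)) (len-toG-reverse Q) ⟩
      len P₁ + len P₂ + len Q ≡⟨ cong (_+ len Q) len-P ⟩
      len P + len Q           ∎)
    where
    open ≡-Reasoning
    toG : ∀ {x y} → Walk (F H) x y → Walk (adj G) x y
    toG = mapʷ (λ {a} {b} → F-adj H a b)
    len-toG : ∀ {x y} (p : Walk (F H) x y) → len (toG p) ≡ len p
    len-toG = len-mapʷ (λ {a} {b} → F-adj H a b)
    len-toG-reverse : ∀ {x y} (p : Walk (F H) x y) → len (toG (reverseʷ (F-sym H) p)) ≡ len p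
    len-toG-reverse p = trans (len-toG (reverseʷ (F-sym H) p)) (len-reverseʷ (F-sym H) p)

  star-≤-edgeCount : ∀ (H : Subgraph G) → SubConnected G H → Contains G H (⁅ u ⁆ ∪ ⁅ v ⁆ ∪ ⁅ w ⁆) →
    Σ (Star G u v w) λ s → size s ≤ edgeCount G H
  star-≤-edgeCount H H-connected S⊆H =
    let P , P! = simplify (H-connected u v (∈H (inj₁ refl)) (∈H (inj₂ (inj₁ refl))))
        R , R! = simplify (H-connected w u (∈H (inj₂ (inj₂ refl))) (∈H (inj₁ refl)))
        _ , Q , m∈P , Q! , Q-avoids-P , _ = firstHit (verts P) R R! (head∈verts P)
        s , size≡ = branchStar H P m∈P Q
    in s , (begin
      size s        ≡⟨ trans size≡ (+-comm (len P) (len Q)) ⟩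
      len Q + len P ≤⟨ simple-avoiding-≤-edgeCount G H P! Q! Q-avoids-P ⟩
      edgeCount G H ∎)
    where
    open ≤-Reasoning
    ∈H : ∀ {x} → x ≡ u ⊎ x ≡ v ⊎ x ≡ w → x ∈ₛ W H
    ∈H x≡ = S⊆H _ (∈-triple⁺ x≡)

  steiner⇒star : ∀ {dS} → IsSteinerDist G (⁅ u ⁆ ∪ ⁅ v ⁆ ∪ ⁅ w ⁆) dS → Σ (Star G u v w) λ s → size s ≤ dS
  steiner⇒star ((H , H-connected , S⊆H , refl) , _) = star-≤-edgeCount H H-connected S⊆H

  module _ {duv duw dvw : ℕ} (uv : IsDist G u v duv) (uw : IsDist G u w duw) (vw : IsDist G v w dvw) where

    pairwise-≤-double-size : (s : Star G u v w) → duv + duw + dvw ≤ 2 * size s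
    pairwise-≤-double-size (star a b c) = begin
      duv + duw + dvw
        ≤⟨ +-mono-≤ (+-mono-≤ (dist-≤-joinAt G uv a b) (dist-≤-joinAt G uw a c)) (dist-≤-joinAt G vw b c) ⟩
      (len a + len b) + (len a + len c) + (len b + len c)
        ≡⟨ sym (double-sum≡pairwise (len a) (len b) (len c)) ⟩
      2 * (len a + len b + len c) ∎
      where open ≤-Reasoning

    double-size-≤⇒median : (s : Star G u v w) → 2 * size s ≤ duv + duw + dvw → IsMedian G u v w (centre s)
    double-size-≤⇒median (star a b c) 2s≤ =
      let ab , ac , bc = squeeze₃ (dist-≤-joinAt G uv a b) (dist-≤-joinAt G uw a c) (dist-≤-joinAt G vw b c)
                           (subst (_≤ duv + duw + dvw) (double-sum≡pairwise (len a) (len b) (len c)) 2s≤)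
      in joinAt-onGeodesic G uv a b ab , joinAt-onGeodesic G uw a c ac , joinAt-onGeodesic G vw b c bc

    median⇒star : ∀ {z} → IsMedian G u v w z → Σ (Star G u v w) λ s → 2 * size s ≡ duv + duw + dvw
    median⇒star (z∈uv , z∈uw , z∈vw)
      with onGeodesic-split G uv z∈uv | onGeodesic-split G uw z∈uw | onGeodesic-split G vw z∈vw
    ... | d₁ , d₂ , uz , zv , d₁+d₂ | d₁′ , d₃ , uz′ , zw , d₁′+d₃ | d₂′ , d₃′ , vz , zw′ , d₂′+d₃′
      with IsDist-sym G uz | zv | zw
    ... | (a , refl) , _ | (b , refl) , _ | (c , refl) , _ =
      star a b c , (begin
        2 * (len a + len b + len c)                         ≡⟨ double-sum≡pairwise (len a) (len b) (len c) ⟩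
        (len a + len b) + (len a + len c) + (len b + len c) ≡⟨ cong₂ _+_ (cong₂ _+_ d₁+d₂ ac) bc ⟩
        duv + duw + dvw ∎)
      where
      open ≡-Reasoning
      ac : len a + len c ≡ duw
      ac = trans (cong (_+ len c) (IsDist-unique G uz uz′)) d₁′+d₃
      bc : len b + len c ≡ dvw
      bc = trans (cong₂ _+_ (IsDist-unique G zv (IsDist-sym G vz)) (IsDist-unique G zw zw′)) d₂′+d₃′

lemma4p2 : (G : Graph) → Connected G → 3 ≤ n G →
    (u v w : Fin (n G)) → u ≢ v → u ≢ w → v ≢ w →
    (dS duv duw dvw : ℕ) →
    IsSteinerDist G (⁅ u ⁆ ∪ ⁅ v ⁆ ∪ ⁅ w ⁆) dS →
    IsDist G u v duv → IsDist G u w duw → IsDist G v w dvw →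
    (∃ (λ z → IsMedian G u v w z)) ⇔ (2 * dS ≡ duv + duw + dvw)
lemma4p2 G _ _ u v w _ _ _ dS duv duw dvw steiner uv uw vw = mk⇔ median⇒equality equality⇒median
  where
  optimal : Star G u v w
  optimal = proj₁ (steiner⇒star G steiner)
  optimal-≤ : size optimal ≤ dS
  optimal-≤ = proj₂ (steiner⇒star G steiner)

  pairwise-≤-double-steiner : duv + duw + dvw ≤ 2 * dS
  pairwise-≤-double-steiner = ≤-trans (pairwise-≤-double-size G uv uw vw optimal) (*-monoʳ-≤ 2 optimal-≤)

  median⇒equality : ∃ (IsMedian G u v w) → 2 * dS ≡ duv + duw + dvw
  median⇒equality (_ , median) =
    let s , 2s≡ = median⇒star G uv uw vw median in
    ≤-antisym (≤-trans (*-monoʳ-≤ 2 (steiner-≤-size G steiner s)) (≤-reflexive 2s≡))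
              pairwise-≤-double-steiner

  equality⇒median : 2 * dS ≡ duv + duw + dvw → ∃ (IsMedian G u v w)
  equality⇒median 2dS≡ =
    centre optimal ,
    double-size-≤⇒median G uv uw vw optimal (≤-trans (*-monoʳ-≤ 2 optimal-≤) (≤-reflexive 2dS≡))
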